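{- For every integer $n \ge 1$, let $\hat{e}_n$ and $\hat{o}_n$ denote the numbers of direct and indirect c-derangements of the $n$-dimensional hypercube $Q_n$, respectively. Then $\hat{e}_n - \hat{o}_n = (-1)^n$.
   Context: Let $Q_n$ be the regular $n$-dimensional hypercube, e.g. $[-1,1]^n\subset\mathbb{R}^n$; its $2n$ facets have centers $\pm e_1,\dots,\pm e_n$. Isometries of $Q_n$ correspond exactly to $n\times n$ signed permutation matrices (permutation matrices with nonzero entries $\pm1$). A c-derangement is an isometry of $Q_n$ fixing no facet, i.e. a signed permutation matrix with no entry $+1$ on its main diagonal. An isometry is direct if its matrix has determinant $1$ (equivalently, it is a product of an even number of reflections) and indirect if its determinant is $-1$. -}

module Defs where

open import Data.Bool using (Bool; true; false; _∧_; not)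
open import Data.Nat using (ℕ; zero; suc)
open import Data.Fin using (Fin; toℕ)
open import Data.Integer using (ℤ; +_; -_; _*_; _+_; 0ℤ; 1ℤ; -1ℤ; _≟_)
open import Data.List using (List; []; _∷_; map; concatMap; length; filterᵇ; foldr)
open import Data.Vec using (Vec; []; _∷_; lookup; removeAt; toList; transpose; allFin)
open import Relation.Nullary.Decidable using (⌊_⌋)

-- n × n integer matrices, as a vector of rows
Matrix : ℕ → Set
Matrix n = Vec (Vec ℤ n) n

negOnePow : ℕ → ℤ
negOnePow zero    = 1ℤ
negOnePow (suc k) = - negOnePow k

sumFin : ∀ {n} → (Fin n → ℤ) → ℤ
sumFin {n} f = foldr _+_ 0ℤ (map f (toList (allFin n)))

det : ∀ {n} → Matrix n → ℤ
det {zero}  []       = 1ℤ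
det {suc n} (r ∷ rs) =
  sumFin (λ j → negOnePow (toℕ j) * (lookup r j * det (Data.Vec.map (λ row → removeAt row j) rs)))

_==_ : ℤ → ℤ → Bool
a == b = ⌊ a ≟ b ⌋

allᵇ : ∀ {A : Set} {n} → (A → Bool) → Vec A n → Bool
allᵇ p []       = true
allᵇ p (x ∷ xs) = p x ∧ allᵇ p xs

nonzeros : ∀ {n} → Vec ℤ n → ℕ
nonzeros []       = zero
nonzeros (x ∷ xs) with x == 0ℤ
... | true  = nonzeros xs
... | false = suc (nonzeros xs)

isOne : ℕ → Bool
isOne (suc zero) = true
isOne _          = false

entryOK : ℤ → Bool
entryOK x = (x == 0ℤ) Data.Bool.∨ ((x == 1ℤ) Data.Bool.∨ (x == -1ℤ))

isSignedPerm : ∀ {n} → Matrix n → Bool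
isSignedPerm M =
  allᵇ (allᵇ entryOK) M ∧
  (allᵇ (λ r → isOne (nonzeros r)) M ∧ allᵇ (λ c → isOne (nonzeros c)) (transpose M))

isCDerangement : ∀ {n} → Matrix n → Bool
isCDerangement {n} M =
  isSignedPerm M ∧ allᵇ (λ i → not (lookup (lookup M i) i == 1ℤ)) (allFin n)

allVecs : ∀ {A : Set} → List A → (n : ℕ) → List (Vec A n)
allVecs xs zero    = [] ∷ []
allVecs xs (suc n) = concatMap (λ x → map (x ∷_) (allVecs xs n)) xs

-- all n × n matrices with entries in {0, 1, -1}; this list contains every
-- signed permutation matrix exactly once
candidateMatrices : (n : ℕ) → List (Matrix n)
candidateMatrices n = allVecs (allVecs (0ℤ ∷ 1ℤ ∷ -1ℤ ∷ []) n) n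

directCDerangements : ℕ → ℕ
directCDerangements n =
  length (filterᵇ (λ M → isCDerangement M ∧ (det M == 1ℤ)) (candidateMatrices n))

indirectCDerangements : ℕ → ℕ
indirectCDerangements n =
  length (filterᵇ (λ M → isCDerangement M ∧ (det M == -1ℤ)) (candidateMatrices n))

-- Write matrices over {0, ±1} and let F mark the positions where an entry +1 is
-- forbidden (the diagonal, for c-derangements). A signed permutation matrix has
-- determinant ±1, so the number of direct minus the number of indirect ones avoiding F
-- is the sum of their determinants. Expanding along the first row, the entry at (0, j)
-- is the only nonzero one of its row and column, and the remaining rows form a signed
-- permutation matrix avoiding the minor pattern of F. Summing over the sign of that
-- entry, +1 and -1 cancel unless +1 is forbidden at (0, j), which leaves -1. By
-- induction the sum therefore obeys the Laplace expansion of the matrix with -1 on F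
-- and 0 elsewhere, and equals its determinant; for the diagonal this is det(-I) = (-1)^n.

module Submission where

open import Defs
open import Data.Nat using (ℕ; _≥_)
open import Data.Integer using (ℤ; +_; _-_)
open import Relation.Binary.PropositionalEquality using (_≡_)

open import Algebra.Bundles using (CommutativeMonoid)
import Algebra.Properties.CommutativeSemigroup as CommutativeSemigroupProperties
open import Data.Bool using (Bool; true; false; not; _∧_; if_then_else_)
open import Data.Bool.Properties
  using (∧-assoc; ∧-zeroʳ; ∧-identityʳ; ∧-conicalˡ; ∧-conicalʳ; ∧-commutativeMonoid; if-∧; if-eta)
open import Data.Fin using (Fin; zero; suc; toℕ; punchIn)
open import Data.Fin.Properties using (_≟_)
open import Data.Integer using (-_; _+_; _*_; 0ℤ; 1ℤ; -1ℤ)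
open import Data.Integer.Properties
  using ( +-identityˡ; +-identityʳ; +-assoc; *-zeroʳ; *-distribˡ-+; neg-distrib-+; -1*i≡-i
        ; +-commutativeSemigroup; *-commutativeSemigroup)
open import Data.Integer.Solver using (module +-*-Solver)
open import Data.List as List using (List; []; _∷_; _++_; foldr; concatMap)
open import Data.Nat as ℕ using (zero; suc; _≤_; z≤n; s≤s)
import Data.Nat.Properties as ℕP
open import Data.Product using (∃-syntax; _,_)
open import Data.Vec as Vec
  using (Vec; []; _∷_; toList; tabulate; allFin; insertAt; removeAt; zipWith; replicate; transpose; lookup)
open import Data.Vec.Properties
  using ( zipWith-is-⊛; insertAt-lookup; removeAt-insertAt; lookup-map; lookup∘tabulate; tabulate-∘
        ; tabulate-cong; map-replicate)
open import Data.Vec.Relation.Unary.All as All using (All; []; _∷_)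
import Data.Vec.Relation.Unary.All.Properties as All
open import Function using (_∘_; id)
open import Relation.Nullary using (does)
open import Relation.Binary.PropositionalEquality
  using (refl; sym; trans; cong; cong₂; subst; module ≡-Reasoning)

open +-*-Solver using (solve; _:*_; _:+_; _:=_; con)
open ≡-Reasoning
module ℤ+ = CommutativeSemigroupProperties +-commutativeSemigroup
module ℤ* = CommutativeSemigroupProperties *-commutativeSemigroup
module ℕ+ = CommutativeSemigroupProperties ℕP.+-commutativeSemigroup
module 𝔹∧ = CommutativeSemigroupProperties (CommutativeMonoid.commutativeSemigroup ∧-commutativeMonoid)

private variable
  A B C : Set
  m n k : ℕ

∑ : List A → (A → ℤ) → ℤ
∑ xs f = foldr _+_ 0ℤ (List.map f xs)

∑-cong : ∀ (xs : List A) {f g : A → ℤ} → (∀ x → f x ≡ g x) → ∑ xs f ≡ ∑ xs g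
∑-cong []       f≗g = refl
∑-cong (x ∷ xs) f≗g = cong₂ _+_ (f≗g x) (∑-cong xs f≗g)

∑-zero : ∀ (xs : List A) {f : A → ℤ} → (∀ x → f x ≡ 0ℤ) → ∑ xs f ≡ 0ℤ
∑-zero []       f≗0 = refl
∑-zero (x ∷ xs) f≗0 = cong₂ _+_ (f≗0 x) (∑-zero xs f≗0)

∑-++ : ∀ (xs ys : List A) f → ∑ (xs ++ ys) f ≡ ∑ xs f + ∑ ys f
∑-++ []       ys f = sym (+-identityˡ _)
∑-++ (x ∷ xs) ys f = trans (cong (_+_ (f x)) (∑-++ xs ys f)) (sym (+-assoc (f x) _ _))

∑-distrib-+ : ∀ (xs : List A) f g → ∑ xs (λ x → f x + g x) ≡ ∑ xs f + ∑ xs g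
∑-distrib-+ []       f g = refl
∑-distrib-+ (x ∷ xs) f g =
  trans (cong (_+_ (f x + g x)) (∑-distrib-+ xs f g)) (ℤ+.interchange (f x) (g x) _ _)

∑-distrib-minus : ∀ (xs : List A) f g → ∑ xs f - ∑ xs g ≡ ∑ xs (λ x → f x - g x)
∑-distrib-minus []       f g = refl
∑-distrib-minus (x ∷ xs) f g = begin
  (f x + ∑ xs f) + - (g x + ∑ xs g)       ≡⟨ cong (_+_ (f x + ∑ xs f)) (neg-distrib-+ (g x) (∑ xs g)) ⟩
  (f x + ∑ xs f) + (- g x + - ∑ xs g)     ≡⟨ ℤ+.interchange (f x) (∑ xs f) (- g x) (- ∑ xs g) ⟩
  (f x - g x) + (∑ xs f - ∑ xs g)         ≡⟨ cong (_+_ (f x - g x)) (∑-distrib-minus xs f g) ⟩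
  (f x - g x) + ∑ xs (λ y → f y - g y)    ∎

*-distribˡ-∑ : ∀ (xs : List A) c f → c * ∑ xs f ≡ ∑ xs (λ x → c * f x)
*-distribˡ-∑ []       c f = *-zeroʳ c
*-distribˡ-∑ (x ∷ xs) c f = trans (*-distribˡ-+ c (f x) _) (cong (_+_ (c * f x)) (*-distribˡ-∑ xs c f))

∑-if : ∀ (xs : List A) b f → ∑ xs (λ x → if b then f x else 0ℤ) ≡ (if b then ∑ xs f else 0ℤ)
∑-if xs true  f = refl
∑-if xs false f = ∑-zero xs (λ _ → refl)

∑-if-* : ∀ (xs : List A) (p : A → Bool) s t (d : A → ℤ) →
  ∑ xs (λ x → if p x then s * (t * d x) else 0ℤ) ≡ s * (t * ∑ xs (λ x → if p x then d x else 0ℤ))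
∑-if-* xs p s t d = begin
  ∑ xs (λ x → if p x then s * (t * d x) else 0ℤ)   ≡⟨ ∑-cong xs (λ x → if-* (p x)) ⟩
  ∑ xs (λ x → s * (t * d′ x))                      ≡⟨ sym (*-distribˡ-∑ xs s _) ⟩
  s * ∑ xs (λ x → t * d′ x)                        ≡⟨ cong (s *_) (sym (*-distribˡ-∑ xs t d′)) ⟩
  s * (t * ∑ xs d′)                                ∎
  where
  d′ = λ x → if p x then d x else 0ℤ
  if-* : ∀ {x} b → (if b then s * (t * d x) else 0ℤ) ≡ s * (t * (if b then d x else 0ℤ))
  if-* true  = refl
  if-* false = sym (trans (cong (s *_) (*-zeroʳ t)) (*-zeroʳ s))

∑-map : ∀ (h : B → A) (xs : List B) f → ∑ (List.map h xs) f ≡ ∑ xs (f ∘ h)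
∑-map h []       f = refl
∑-map h (x ∷ xs) f = cong (_+_ (f (h x))) (∑-map h xs f)

∑-concatMap : ∀ (g : B → List A) (xs : List B) f → ∑ (concatMap g xs) f ≡ ∑ xs (λ x → ∑ (g x) f)
∑-concatMap g []       f = refl
∑-concatMap g (x ∷ xs) f =
  trans (∑-++ (g x) (concatMap g xs) f) (cong (_+_ (∑ (g x) f)) (∑-concatMap g xs f))

∑-comm : ∀ (xs : List A) (ys : List B) (f : A → B → ℤ) →
         ∑ xs (λ x → ∑ ys (f x)) ≡ ∑ ys (λ y → ∑ xs (λ x → f x y))
∑-comm []       ys f = sym (∑-zero ys (λ _ → refl))
∑-comm (x ∷ xs) ys f =
  trans (cong (_+_ (∑ ys (f x))) (∑-comm xs ys f)) (sym (∑-distrib-+ ys (f x) _))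

length-filterᵇ : ∀ (q : A → Bool) (xs : List A) →
  + List.length (List.filterᵇ q xs) ≡ ∑ xs (λ x → if q x then 1ℤ else 0ℤ)
length-filterᵇ q []       = refl
length-filterᵇ q (x ∷ xs) with q x
... | true  = cong (_+_ 1ℤ) (length-filterᵇ q xs)
... | false = trans (length-filterᵇ q xs) (sym (+-identityˡ _))

-- sumFin f unfolds to ∑ (toList (allFin n)) f, so the lemmas on ∑ apply to it directly.
sumFin-tabulate : ∀ (g : Fin n → A) (f : A → ℤ) → ∑ (toList (tabulate g)) f ≡ sumFin (f ∘ g)
sumFin-tabulate {zero}  g f = refl
sumFin-tabulate {suc n} g f =
  cong (_+_ (f (g zero))) (trans (sumFin-tabulate (g ∘ suc) f) (sym (sumFin-tabulate suc (f ∘ g))))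

sumFin-suc : ∀ (f : Fin (suc n) → ℤ) → sumFin f ≡ f zero + sumFin (f ∘ suc)
sumFin-suc f = cong (_+_ (f zero)) (sumFin-tabulate suc f)

transpose-∷ : ∀ (a : Vec A n) (M : Vec (Vec A n) k) → transpose (a ∷ M) ≡ zipWith _∷_ a (transpose M)
transpose-∷ a M = sym (zipWith-is-⊛ _∷_ a (transpose M))

zipWith-∷-map : ∀ (f : A → B) (a : Vec A n) (T : Vec (Vec A k) n) →
  zipWith _∷_ (Vec.map f a) (Vec.map (Vec.map f) T) ≡ Vec.map (Vec.map f) (zipWith _∷_ a T)
zipWith-∷-map f []      []      = refl
zipWith-∷-map f (x ∷ a) (t ∷ T) = cong (_ ∷_) (zipWith-∷-map f a T)

transpose-map : ∀ (f : A → B) (M : Vec (Vec A n) k) →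
  transpose (Vec.map (Vec.map f) M) ≡ Vec.map (Vec.map f) (transpose M)
transpose-map {n = n} f [] = sym (map-replicate (Vec.map f) [] n)
transpose-map f (a ∷ M) = begin
  transpose (Vec.map f a ∷ Vec.map (Vec.map f) M)
    ≡⟨ transpose-∷ (Vec.map f a) (Vec.map (Vec.map f) M) ⟩
  zipWith _∷_ (Vec.map f a) (transpose (Vec.map (Vec.map f) M))
    ≡⟨ cong (zipWith _∷_ (Vec.map f a)) (transpose-map f M) ⟩
  zipWith _∷_ (Vec.map f a) (Vec.map (Vec.map f) (transpose M))
    ≡⟨ zipWith-∷-map f a (transpose M) ⟩
  Vec.map (Vec.map f) (zipWith _∷_ a (transpose M))
    ≡⟨ cong (Vec.map (Vec.map f)) (sym (transpose-∷ a M)) ⟩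
  Vec.map (Vec.map f) (transpose (a ∷ M)) ∎

insertAt-replicate : ∀ (x : A) n (j : Fin (suc n)) → insertAt (replicate n x) j x ≡ replicate (suc n) x
insertAt-replicate x n       zero    = refl
insertAt-replicate x (suc n) (suc j) = cong (x ∷_) (insertAt-replicate x n j)

zipWith-insertAt : ∀ (f : A → B → C) (a : Vec A n) (b : Vec B n) j x y →
                   zipWith f (insertAt a j x) (insertAt b j y) ≡ insertAt (zipWith f a b) j (f x y)
zipWith-insertAt f a        b        zero    x y = refl
zipWith-insertAt f (a ∷ as) (b ∷ bs) (suc j) x y = cong (f a b ∷_) (zipWith-insertAt f as bs j x y)

insertColumn : Fin (suc n) → Vec A m → Vec (Vec A n) m → Vec (Vec A (suc n)) m
insertColumn j = zipWith (λ c row → insertAt row j c)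

transpose-insertColumn : ∀ (j : Fin (suc n)) (cs : Vec A k) (N : Vec (Vec A n) k) →
                         transpose (insertColumn j cs N) ≡ insertAt (transpose N) j cs
transpose-insertColumn j []       []      = sym (insertAt-replicate [] _ j)
transpose-insertColumn j (c ∷ cs) (a ∷ N) = begin
  transpose (insertAt a j c ∷ insertColumn j cs N)
    ≡⟨ transpose-∷ (insertAt a j c) (insertColumn j cs N) ⟩
  zipWith _∷_ (insertAt a j c) (transpose (insertColumn j cs N))
    ≡⟨ cong (zipWith _∷_ (insertAt a j c)) (transpose-insertColumn j cs N) ⟩
  zipWith _∷_ (insertAt a j c) (insertAt (transpose N) j cs)
    ≡⟨ zipWith-insertAt _∷_ a (transpose N) j c cs ⟩
  insertAt (zipWith _∷_ a (transpose N)) j (c ∷ cs)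
    ≡⟨ cong (λ t → insertAt t j (c ∷ cs)) (sym (transpose-∷ a N)) ⟩
  insertAt (transpose (a ∷ N)) j (c ∷ cs) ∎

minor : Fin (suc n) → Vec (Vec A (suc n)) k → Vec (Vec A n) k
minor j = Vec.map (λ row → removeAt row j)

minor-insertColumn : ∀ (j : Fin (suc n)) (cs : Vec A k) (N : Vec (Vec A n) k) → minor j (insertColumn j cs N) ≡ N
minor-insertColumn j []       []      = refl
minor-insertColumn j (c ∷ cs) (r ∷ N) = cong₂ _∷_ (removeAt-insertAt r j c) (minor-insertColumn j cs N)

removeAt-map : ∀ (f : A → B) (v : Vec A (suc n)) j → removeAt (Vec.map f v) j ≡ Vec.map f (removeAt v j)
removeAt-map f (x ∷ v)     zero    = refl
removeAt-map f (x ∷ y ∷ v) (suc j) = cong (f x ∷_) (removeAt-map f (y ∷ v) j)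

removeAt-tabulate : ∀ (f : Fin (suc n) → A) j → removeAt (tabulate f) j ≡ tabulate (f ∘ punchIn j)
removeAt-tabulate {zero}  f zero    = refl
removeAt-tabulate {suc n} f zero    = refl
removeAt-tabulate {suc n} f (suc j) = cong (f zero ∷_) (removeAt-tabulate (f ∘ suc) j)

allᵇ-insertAt : ∀ (P : A → Bool) (V : Vec A n) j v → allᵇ P (insertAt V j v) ≡ P v ∧ allᵇ P V
allᵇ-insertAt P V       zero    v = refl
allᵇ-insertAt P (y ∷ V) (suc j) v =
  trans (cong (P y ∧_) (allᵇ-insertAt P V j v)) (𝔹∧.x∙yz≈y∙xz (P y) (P v) _)

allᵇ-tabulate : ∀ (P : A → Bool) (f : Fin n → A) → allᵇ P (tabulate f) ≡ allᵇ (P ∘ f) (allFin n)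
allᵇ-tabulate {n = zero}  P f = refl
allᵇ-tabulate {n = suc n} P f =
  cong (P (f zero) ∧_) (trans (allᵇ-tabulate P (f ∘ suc)) (sym (allᵇ-tabulate (P ∘ f) suc)))

-- Enumerating vectors

∑-allVecs-∷ : ∀ (L : List A) n (h : Vec A (suc n) → ℤ) →
              ∑ (allVecs L (suc n)) h ≡ ∑ L (λ x → ∑ (allVecs L n) (λ v → h (x ∷ v)))
∑-allVecs-∷ L n h = trans (∑-concatMap _ L h) (∑-cong L (λ x → ∑-map (x ∷_) (allVecs L n) h))

∑-allVecs-insertAt : ∀ (L : List A) n (j : Fin (suc n)) (h : Vec A (suc n) → ℤ) →
  ∑ (allVecs L (suc n)) h ≡ ∑ L (λ x → ∑ (allVecs L n) (λ v → h (insertAt v j x)))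
∑-allVecs-insertAt L n       zero    h = ∑-allVecs-∷ L n h
∑-allVecs-insertAt L (suc n) (suc j) h = begin
  ∑ (allVecs L (suc (suc n))) h
    ≡⟨ ∑-allVecs-∷ L (suc n) h ⟩
  ∑ L (λ y → ∑ (allVecs L (suc n)) (λ v → h (y ∷ v)))
    ≡⟨ ∑-cong L (λ y → ∑-allVecs-insertAt L n j (λ v → h (y ∷ v))) ⟩
  ∑ L (λ y → ∑ L (λ x → ∑ (allVecs L n) (λ v → h (y ∷ insertAt v j x))))
    ≡⟨ ∑-comm L L _ ⟩
  ∑ L (λ x → ∑ L (λ y → ∑ (allVecs L n) (λ v → h (y ∷ insertAt v j x))))
    ≡⟨ ∑-cong L (λ x → sym (∑-allVecs-∷ L n (λ v → h (insertAt v (suc j) x)))) ⟩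
  ∑ L (λ x → ∑ (allVecs L (suc n)) (λ v → h (insertAt v (suc j) x))) ∎

∑-allVecs-insertColumn : ∀ (L : List A) n m (j : Fin (suc n)) (h : Vec (Vec A (suc n)) m → ℤ) →
  ∑ (allVecs (allVecs L (suc n)) m) h ≡
  ∑ (allVecs L m) (λ cs → ∑ (allVecs (allVecs L n) m) (λ N → h (insertColumn j cs N)))
∑-allVecs-insertColumn L n zero    j h = sym (+-identityʳ _)
∑-allVecs-insertColumn L n (suc m) j h = begin
  ∑ (allVecs R (suc m)) h
    ≡⟨ ∑-allVecs-∷ R m h ⟩
  ∑ R (λ r → ∑ (allVecs R m) (λ rs → h (r ∷ rs)))
    ≡⟨ ∑-cong R (λ r → ∑-allVecs-insertColumn L n m j (λ rs → h (r ∷ rs))) ⟩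
  ∑ R (λ r → ∑ (allVecs L m) (λ cs → ∑ (allVecs R' m) (λ N → h (r ∷ insertColumn j cs N))))
    ≡⟨ ∑-allVecs-insertAt L n j _ ⟩
  ∑ L (λ x → ∑ R' (λ r → ∑ (allVecs L m) (λ cs → ∑ (allVecs R' m) (λ N →
    h (insertColumn j (x ∷ cs) (r ∷ N))))))
    ≡⟨ ∑-cong L (λ x → ∑-comm R' (allVecs L m) _) ⟩
  ∑ L (λ x → ∑ (allVecs L m) (λ cs → ∑ R' (λ r → ∑ (allVecs R' m) (λ N →
    h (insertColumn j (x ∷ cs) (r ∷ N))))))
    ≡⟨ ∑-cong L (λ x → ∑-cong (allVecs L m) (λ cs →
         sym (∑-allVecs-∷ R' m (λ N → h (insertColumn j (x ∷ cs) N))))) ⟩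
  ∑ L (λ x → ∑ (allVecs L m) (λ cs → ∑ (allVecs R' (suc m)) (λ N → h (insertColumn j (x ∷ cs) N))))
    ≡⟨ sym (∑-allVecs-∷ L m _) ⟩
  ∑ (allVecs L (suc m)) (λ cs → ∑ (allVecs R' (suc m)) (λ N → h (insertColumn j cs N))) ∎
  where
  R  = allVecs L (suc n)
  R' = allVecs L n

∑-allVecs-map : ∀ (f : B → A) (L : List A) (L' : List B) → (∀ h → ∑ L h ≡ ∑ L' (h ∘ f)) →
  ∀ n (h : Vec A n → ℤ) → ∑ (allVecs L n) h ≡ ∑ (allVecs L' n) (h ∘ Vec.map f)
∑-allVecs-map f L L' L≈L' zero    h = refl
∑-allVecs-map f L L' L≈L' (suc n) h = begin
  ∑ (allVecs L (suc n)) h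
    ≡⟨ ∑-allVecs-∷ L n h ⟩
  ∑ L (λ a → ∑ (allVecs L n) (λ v → h (a ∷ v)))
    ≡⟨ L≈L' _ ⟩
  ∑ L' (λ b → ∑ (allVecs L n) (λ v → h (f b ∷ v)))
    ≡⟨ ∑-cong L' (λ b → ∑-allVecs-map f L L' L≈L' n (λ v → h (f b ∷ v))) ⟩
  ∑ L' (λ b → ∑ (allVecs L' n) (λ w → h (f b ∷ Vec.map f w)))
    ≡⟨ sym (∑-allVecs-∷ L' n _) ⟩
  ∑ (allVecs L' (suc n)) (h ∘ Vec.map f) ∎

-- Signed permutation matrices avoiding a pattern

data Entry : Set where
  zer pos neg : Entry

toℤ : Entry → ℤ
toℤ zer = 0ℤ
toℤ pos = 1ℤ
toℤ neg = -1ℤ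

entries : List Entry
entries = zer ∷ pos ∷ neg ∷ []

weight : Entry → ℕ
weight zer = 0
weight _   = 1

nonzeroCount : Vec Entry n → ℕ
nonzeroCount []      = 0
nonzeroCount (x ∷ v) = weight x ℕ.+ nonzeroCount v

isZero : Entry → Bool
isZero zer = true
isZero _   = false

allZero : Vec Entry n → Bool
allZero = allᵇ isZero

oneNonzeroPerRow : Vec (Vec Entry n) k → Bool
oneNonzeroPerRow = allᵇ (λ r → isOne (nonzeroCount r))

isSignedPermᴱ : Vec (Vec Entry n) k → Bool
isSignedPermᴱ M = oneNonzeroPerRow M ∧ oneNonzeroPerRow (transpose M)

-- A pattern F marks the positions where an entry +1 is forbidden.
allowed : Bool → Entry → Bool
allowed forbidden pos = not forbidden
allowed _         _   = true

avoidsRow : (Fin n → Bool) → Vec Entry n → Bool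
avoidsRow f []      = true
avoidsRow f (x ∷ v) = allowed (f zero) x ∧ avoidsRow (f ∘ suc) v

avoids : (Fin k → Fin n → Bool) → Vec (Vec Entry n) k → Bool
avoids F []       = true
avoids F (r ∷ rs) = avoidsRow (F zero) r ∧ avoids (F ∘ suc) rs

admissible : (Fin k → Fin n → Bool) → Vec (Vec Entry n) k → Bool
admissible F M = isSignedPermᴱ M ∧ avoids F M

minorPattern : (Fin (suc k) → Fin (suc n) → Bool) → Fin (suc n) → Fin k → Fin n → Bool
minorPattern F j i = F (suc i) ∘ punchIn j

isOne-suc-nonzeroCount : ∀ (v : Vec Entry n) → isOne (suc (nonzeroCount v)) ≡ allZero v
isOne-suc-nonzeroCount []      = refl
isOne-suc-nonzeroCount (zer ∷ v) = isOne-suc-nonzeroCount v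
isOne-suc-nonzeroCount (pos ∷ v) = refl
isOne-suc-nonzeroCount (neg ∷ v) = refl

nonzeroCount-insertAt : ∀ (r : Vec Entry n) j x → nonzeroCount (insertAt r j x) ≡ weight x ℕ.+ nonzeroCount r
nonzeroCount-insertAt r       zero    x = refl
nonzeroCount-insertAt (y ∷ r) (suc j) x =
  trans (cong (weight y ℕ.+_) (nonzeroCount-insertAt r j x)) (ℕ+.x∙yz≈y∙xz (weight y) (weight x) _)

nonzeroCount-removeAt : ∀ (r : Vec Entry (suc n)) j → nonzeroCount (removeAt r j) ≤ nonzeroCount r
nonzeroCount-removeAt (x ∷ r)     zero    = ℕP.m≤n+m (nonzeroCount r) (weight x)
nonzeroCount-removeAt (x ∷ y ∷ r) (suc j) = ℕP.+-monoʳ-≤ (weight x) (nonzeroCount-removeAt (y ∷ r) j)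

isOne⇒≤1 : ∀ k → isOne k ≡ true → k ≤ 1
isOne⇒≤1 (suc zero) _ = s≤s z≤n

oneNonzeroPerRow⇒≤1 : ∀ (M : Vec (Vec Entry n) k) → oneNonzeroPerRow M ≡ true →
  All (λ r → nonzeroCount r ≤ 1) M
oneNonzeroPerRow⇒≤1 []      _ = []
oneNonzeroPerRow⇒≤1 (r ∷ M) h =
  isOne⇒≤1 _ (∧-conicalˡ _ _ h) ∷ oneNonzeroPerRow⇒≤1 M (∧-conicalʳ _ _ h)

oneNonzeroPerRow-insertColumn-zeros : ∀ (j : Fin (suc n)) (N : Vec (Vec Entry n) k) →
  oneNonzeroPerRow (insertColumn j (replicate k zer) N) ≡ oneNonzeroPerRow N
oneNonzeroPerRow-insertColumn-zeros j []      = refl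
oneNonzeroPerRow-insertColumn-zeros j (r ∷ N) =
  cong₂ _∧_ (cong isOne (nonzeroCount-insertAt r j zer)) (oneNonzeroPerRow-insertColumn-zeros j N)

oneNonzeroPerRow-zeros∷ : ∀ (T : Vec (Vec Entry k) n) →
  oneNonzeroPerRow (zipWith _∷_ (replicate n zer) T) ≡ oneNonzeroPerRow T
oneNonzeroPerRow-zeros∷ []      = refl
oneNonzeroPerRow-zeros∷ (t ∷ T) = cong (isOne (nonzeroCount t) ∧_) (oneNonzeroPerRow-zeros∷ T)

allowed-false : ∀ x → allowed false x ≡ true
allowed-false zer = refl
allowed-false pos = refl
allowed-false neg = refl

avoidsRow-never : ∀ (r : Vec Entry n) → avoidsRow (λ _ → false) r ≡ true
avoidsRow-never []      = refl
avoidsRow-never (x ∷ r) = cong₂ _∧_ (allowed-false x) (avoidsRow-never r)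

avoidsRow-zeros : ∀ (f : Fin n → Bool) → avoidsRow f (replicate n zer) ≡ true
avoidsRow-zeros {zero}  f = refl
avoidsRow-zeros {suc n} f = avoidsRow-zeros (f ∘ suc)

avoidsRow-insertAt-zeros : ∀ (f : Fin (suc n) → Bool) j x →
  avoidsRow f (insertAt (replicate n zer) j x) ≡ allowed (f j) x
avoidsRow-insertAt-zeros         f zero    x =
  trans (cong (allowed (f zero) x ∧_) (avoidsRow-zeros (f ∘ suc))) (∧-identityʳ _)
avoidsRow-insertAt-zeros {suc n} f (suc j) x = avoidsRow-insertAt-zeros (f ∘ suc) j x

avoidsRow-insertAt-zer : ∀ (f : Fin (suc n) → Bool) j (r : Vec Entry n) →
  avoidsRow f (insertAt r j zer) ≡ avoidsRow (f ∘ punchIn j) r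
avoidsRow-insertAt-zer f zero    r       = refl
avoidsRow-insertAt-zer f (suc j) (y ∷ r) = cong (allowed (f zero) y ∧_) (avoidsRow-insertAt-zer (f ∘ suc) j r)

avoids-insertColumn-zeros : ∀ (G : Fin k → Fin (suc n) → Bool) j (N : Vec (Vec Entry n) k) →
  avoids G (insertColumn j (replicate k zer) N) ≡ avoids (λ i → G i ∘ punchIn j) N
avoids-insertColumn-zeros G j []      = refl
avoids-insertColumn-zeros G j (r ∷ N) =
  cong₂ _∧_ (avoidsRow-insertAt-zer (G zero) j r) (avoids-insertColumn-zeros (G ∘ suc) j N)

∧-pull : ∀ a b c d e → ((a ∧ b) ∧ (c ∧ d)) ∧ e ≡ a ∧ (c ∧ ((b ∧ d) ∧ e))
∧-pull false b     c d e = refl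
∧-pull true  false c d e = sym (∧-zeroʳ c)
∧-pull true  true  c d e = ∧-assoc c d e

-- A nonzero entry at (0, j) forces the rest of row 0 and of column j to vanish.
admissible-insert : ∀ (F : Fin (suc n) → Fin (suc n) → Bool) (j : Fin (suc n)) x
  (r : Vec Entry n) (cs : Vec Entry n) (N : Vec (Vec Entry n) n) → weight x ≡ 1 →
  admissible F (insertAt r j x ∷ insertColumn j cs N) ≡
  allZero r ∧ (allZero cs ∧ ((oneNonzeroPerRow (insertColumn j cs N) ∧ oneNonzeroPerRow (transpose (r ∷ N)))
                            ∧ avoids F (insertAt r j x ∷ insertColumn j cs N)))
admissible-insert F j x r cs N wx≡1 = trans
  (cong (_∧ avoids F (insertAt r j x ∷ insertColumn j cs N)) (cong₂ _∧_ firstRow columns))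
  (∧-pull (allZero r) _ (allZero cs) _ _)
  where
  onlyNonzero : ∀ {m} (v : Vec Entry m) → isOne (weight x ℕ.+ nonzeroCount v) ≡ allZero v
  onlyNonzero v = trans (cong (λ w → isOne (w ℕ.+ nonzeroCount v)) wx≡1) (isOne-suc-nonzeroCount v)
  firstRow : isOne (nonzeroCount (insertAt r j x)) ∧ oneNonzeroPerRow (insertColumn j cs N)
           ≡ allZero r ∧ oneNonzeroPerRow (insertColumn j cs N)
  firstRow = cong (_∧ oneNonzeroPerRow (insertColumn j cs N))
                   (trans (cong isOne (nonzeroCount-insertAt r j x)) (onlyNonzero r))
  columns : oneNonzeroPerRow (transpose (insertAt r j x ∷ insertColumn j cs N))
          ≡ allZero cs ∧ oneNonzeroPerRow (transpose (r ∷ N))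
  columns = begin
    oneNonzeroPerRow (transpose (insertAt r j x ∷ insertColumn j cs N))
      ≡⟨ cong oneNonzeroPerRow (transpose-insertColumn j (x ∷ cs) (r ∷ N)) ⟩
    oneNonzeroPerRow (insertAt (transpose (r ∷ N)) j (x ∷ cs))
      ≡⟨ allᵇ-insertAt _ (transpose (r ∷ N)) j (x ∷ cs) ⟩
    isOne (weight x ℕ.+ nonzeroCount cs) ∧ oneNonzeroPerRow (transpose (r ∷ N))
      ≡⟨ cong (_∧ oneNonzeroPerRow (transpose (r ∷ N))) (onlyNonzero cs) ⟩
    allZero cs ∧ oneNonzeroPerRow (transpose (r ∷ N)) ∎

admissible-zeros : ∀ (F : Fin (suc n) → Fin (suc n) → Bool) (j : Fin (suc n)) x (N : Vec (Vec Entry n) n) →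
  let 0s = replicate n zer in
  (oneNonzeroPerRow (insertColumn j 0s N) ∧ oneNonzeroPerRow (transpose (0s ∷ N)))
    ∧ avoids F (insertAt 0s j x ∷ insertColumn j 0s N)
  ≡ allowed (F zero j) x ∧ admissible (minorPattern F j) N
admissible-zeros F j x N = trans
  (cong₂ _∧_
    (cong₂ _∧_ (oneNonzeroPerRow-insertColumn-zeros j N)
               (trans (cong oneNonzeroPerRow (transpose-∷ _ N)) (oneNonzeroPerRow-zeros∷ (transpose N))))
    (cong₂ _∧_ (avoidsRow-insertAt-zeros (F zero) j x) (avoids-insertColumn-zeros (F ∘ suc) j N)))
  (𝔹∧.x∙yz≈y∙xz (isSignedPermᴱ N) (allowed (F zero j) x) _)

∑-allVecs-allZero : ∀ n (T : Vec Entry n → ℤ) →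
  ∑ (allVecs entries n) (λ v → if allZero v then T v else 0ℤ) ≡ T (replicate n zer)
∑-allVecs-allZero zero    T = +-identityʳ _
∑-allVecs-allZero (suc n) T = trans (∑-allVecs-∷ entries n _) (trans
  (cong₂ _+_ (∑-allVecs-allZero n (T ∘ (zer ∷_)))
             (cong₂ _+_ (∑-zero (allVecs entries n) (λ _ → refl))
                        (cong₂ _+_ (∑-zero (allVecs entries n) (λ _ → refl)) refl)))
  (+-identityʳ _))

∑-allVecs-allZero² : ∀ (Ns : List B) (g : Vec Entry n → Vec Entry n → B → Bool) (w : B → ℤ) →
  ∑ (allVecs entries n) (λ r → ∑ (allVecs entries n) (λ cs → ∑ Ns (λ N →
    if allZero r ∧ (allZero cs ∧ g r cs N) then w N else 0ℤ)))
  ≡ ∑ Ns (λ N → if g (replicate n zer) (replicate n zer) N then w N else 0ℤ)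
∑-allVecs-allZero² {n = n} Ns g w = begin
  ∑ Vs (λ r → ∑ Vs (λ cs → ∑ Ns (λ N → if allZero r ∧ (allZero cs ∧ g r cs N) then w N else 0ℤ)))
    ≡⟨ ∑-cong Vs (λ r → trans (∑-cong Vs (λ cs → trans (∑-cong Ns (λ N → if-∧ (allZero r)))
                                                        (∑-if Ns (allZero r) _)))
                              (∑-if Vs (allZero r) _)) ⟩
  ∑ Vs (λ r → if allZero r then ∑ Vs (λ cs → ∑ Ns (λ N → if allZero cs ∧ g r cs N then w N else 0ℤ)) else 0ℤ)
    ≡⟨ ∑-allVecs-allZero n _ ⟩
  ∑ Vs (λ cs → ∑ Ns (λ N → if allZero cs ∧ g 0s cs N then w N else 0ℤ))
    ≡⟨ ∑-cong Vs (λ cs → trans (∑-cong Ns (λ N → if-∧ (allZero cs))) (∑-if Ns (allZero cs) _)) ⟩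
  ∑ Vs (λ cs → if allZero cs then ∑ Ns (λ N → if g 0s cs N then w N else 0ℤ) else 0ℤ)
    ≡⟨ ∑-allVecs-allZero n _ ⟩
  ∑ Ns (λ N → if g 0s 0s N then w N else 0ℤ) ∎
  where
  Vs = allVecs entries n
  0s = replicate n zer

-- Determinants

toℤᴹ : Vec (Vec Entry n) k → Vec (Vec ℤ n) k
toℤᴹ = Vec.map (Vec.map toℤ)

detᴱ : Vec (Vec Entry n) n → ℤ
detᴱ M = det (toℤᴹ M)

cofactorSign : Fin n → ℤ
cofactorSign j = negOnePow (toℕ j)

minor-toℤᴹ : ∀ (j : Fin (suc n)) (rs : Vec (Vec Entry (suc n)) k) → minor j (toℤᴹ rs) ≡ toℤᴹ (minor j rs)
minor-toℤᴹ j []       = refl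
minor-toℤᴹ j (r ∷ rs) = cong₂ _∷_ (removeAt-map toℤ r j) (minor-toℤᴹ j rs)

detᴱ-laplace : ∀ (r : Vec Entry (suc n)) (rs : Vec (Vec Entry (suc n)) n) →
  detᴱ (r ∷ rs) ≡ sumFin (λ j → cofactorSign j * (toℤ (lookup r j) * detᴱ (minor j rs)))
detᴱ-laplace r rs = ∑-cong (toList (allFin _)) (λ j →
  cong (cofactorSign j *_) (cong₂ _*_ (lookup-map j toℤ r) (cong det (minor-toℤᴹ j rs))))

negIf : Bool → ℤ
negIf b = if b then -1ℤ else 0ℤ

negIndicator : (Fin k → Fin n → Bool) → Vec (Vec ℤ n) k
negIndicator F = tabulate (λ i → tabulate (negIf ∘ F i))

det-negIndicator-laplace : ∀ (F : Fin (suc n) → Fin (suc n) → Bool) →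
  det (negIndicator F) ≡
  sumFin (λ j → cofactorSign j * (negIf (F zero j) * det (negIndicator (minorPattern F j))))
det-negIndicator-laplace F = ∑-cong (toList (allFin _)) (λ j → cong (cofactorSign j *_) (cong₂ _*_
  (lookup∘tabulate (negIf ∘ F zero) j)
  (cong det (trans (sym (tabulate-∘ (λ row → removeAt row j) (λ i → tabulate (negIf ∘ F (suc i)))))
                   (tabulate-cong (λ i → removeAt-tabulate (negIf ∘ F (suc i)) j))))))

diagonal : Fin n → Fin n → Bool
diagonal i l = does (i ≟ l)

det-negIdentity : ∀ n → det (negIndicator (diagonal {n})) ≡ negOnePow n
det-negIdentity zero    = refl
det-negIdentity (suc n) = begin
  det (negIndicator I)
    ≡⟨ det-negIndicator-laplace I ⟩
  sumFin cofactorExpansion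
    ≡⟨ sumFin-suc cofactorExpansion ⟩
  cofactorExpansion zero + sumFin (cofactorExpansion ∘ suc)
    ≡⟨ cong₂ _+_ (cong (λ d → 1ℤ * (-1ℤ * d)) (det-negIdentity n))
                 (∑-zero (toList (allFin n)) (λ j → *-zeroʳ (cofactorSign {suc n} (suc j)))) ⟩
  1ℤ * (-1ℤ * negOnePow n) + 0ℤ
    ≡⟨ solve 1 (λ p → con 1ℤ :* (con -1ℤ :* p) :+ con 0ℤ := con -1ℤ :* p) refl (negOnePow n) ⟩
  -1ℤ * negOnePow n
    ≡⟨ -1*i≡-i (negOnePow n) ⟩
  negOnePow (suc n) ∎
  where
  I = diagonal {suc n}
  cofactorExpansion : Fin (suc n) → ℤ
  cofactorExpansion j = cofactorSign j * (negIf (I zero j) * det (negIndicator (minorPattern I j)))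

-- Determinants of signed permutation matrices

Trivalent : ℤ → Set
Trivalent d = ∃[ x ] toℤ x ≡ d

opposite : Entry → Entry
opposite zer = zer
opposite pos = neg
opposite neg = pos

_·_ : Entry → Entry → Entry
zer · _ = zer
pos · y = y
neg · y = opposite y

toℤ-· : ∀ x y → toℤ (x · y) ≡ toℤ x * toℤ y
toℤ-· zer zer = refl
toℤ-· zer pos = refl
toℤ-· zer neg = refl
toℤ-· pos zer = refl
toℤ-· pos pos = refl
toℤ-· pos neg = refl
toℤ-· neg zer = refl
toℤ-· neg pos = refl
toℤ-· neg neg = refl

trivalent-* : ∀ {a b} → Trivalent a → Trivalent b → Trivalent (a * b)
trivalent-* (x , refl) (y , refl) = x · y , toℤ-· x y

trivalent-negOnePow : ∀ t → Trivalent (negOnePow t)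
trivalent-negOnePow zero    = pos , refl
trivalent-negOnePow (suc t) = subst Trivalent (-1*i≡-i (negOnePow t))
  (trivalent-* (neg , refl) (trivalent-negOnePow t))

sumFin-zeroRow : ∀ (r : Vec Entry n) (e : Fin n → ℤ) → nonzeroCount r ≡ 0 →
  sumFin (λ j → toℤ (lookup r j) * e j) ≡ 0ℤ
sumFin-zeroRow []        e _  = refl
sumFin-zeroRow (zer ∷ r) e nc≡0 =
  trans (sumFin-suc (λ j → toℤ (lookup (zer ∷ r) j) * e j))
        (trans (+-identityˡ _) (sumFin-zeroRow r (e ∘ suc) nc≡0))

trivalent-leadingRowSum : ∀ x (r : Vec Entry n) (e : Fin (suc n) → ℤ) →
  nonzeroCount r ≡ 0 → Trivalent (e zero) → Trivalent (sumFin (λ j → toℤ (lookup (x ∷ r) j) * e j))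
trivalent-leadingRowSum x r e nc≡0 t = subst Trivalent (sym (begin
  sumFin (λ j → toℤ (lookup (x ∷ r) j) * e j)
    ≡⟨ sumFin-suc (λ j → toℤ (lookup (x ∷ r) j) * e j) ⟩
  toℤ x * e zero + sumFin (λ j → toℤ (lookup r j) * e (suc j))
    ≡⟨ cong (_+_ (toℤ x * e zero)) (sumFin-zeroRow r (e ∘ suc) nc≡0) ⟩
  toℤ x * e zero + 0ℤ
    ≡⟨ +-identityʳ _ ⟩
  toℤ x * e zero ∎))
  (trivalent-* (x , refl) t)

trivalent-rowSum : ∀ (r : Vec Entry n) (e : Fin n → ℤ) →
  nonzeroCount r ≤ 1 → (∀ j → Trivalent (e j)) → Trivalent (sumFin (λ j → toℤ (lookup r j) * e j))
trivalent-rowSum []        e _   _ = zer , refl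
trivalent-rowSum (zer ∷ r) e nc≤1 t =
  subst Trivalent (sym (trans (sumFin-suc (λ j → toℤ (lookup (zer ∷ r) j) * e j)) (+-identityˡ _)))
        (trivalent-rowSum r (e ∘ suc) nc≤1 (t ∘ suc))
trivalent-rowSum (pos ∷ r) e (s≤s nc≤0) t = trivalent-leadingRowSum pos r e (ℕP.n≤0⇒n≡0 nc≤0) (t zero)
trivalent-rowSum (neg ∷ r) e (s≤s nc≤0) t = trivalent-leadingRowSum neg r e (ℕP.n≤0⇒n≡0 nc≤0) (t zero)

trivalent-detᴱ : ∀ (M : Vec (Vec Entry n) n) → All (λ r → nonzeroCount r ≤ 1) M → Trivalent (detᴱ M)
trivalent-detᴱ {zero}  []       []       = pos , refl
trivalent-detᴱ {suc n} (r ∷ rs) (h ∷ hs) = subst Trivalent (sym laplace)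
  (trivalent-rowSum r cofactor h (λ j → trivalent-* (trivalent-negOnePow (toℕ j))
    (trivalent-detᴱ (minor j rs) (All.map⁺ (All.map (λ {r} → ℕP.≤-trans (nonzeroCount-removeAt r j)) hs)))))
  where
  cofactor : Fin (suc n) → ℤ
  cofactor j = cofactorSign j * detᴱ (minor j rs)
  laplace : detᴱ (r ∷ rs) ≡ sumFin (λ j → toℤ (lookup r j) * cofactor j)
  laplace = trans (detᴱ-laplace r rs) (∑-cong (toList (allFin _)) (λ j →
    ℤ*.x∙yz≈y∙xz (cofactorSign j) (toℤ (lookup r j)) (detᴱ (minor j rs))))

admissibleDetSum : (Fin n → Fin n → Bool) → ℤ
admissibleDetSum {n} F = ∑ (allVecs (allVecs entries n) n) (λ M → if admissible F M then detᴱ M else 0ℤ)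

-- The entries +1 and -1 cancel unless +1 is forbidden, in which case only -1 survives.
∑-allowed : ∀ b s D → ∑ entries (λ x → if allowed b x then s * (toℤ x * D) else 0ℤ) ≡ s * (negIf b * D)
∑-allowed true  = solve 2 (λ s D → s :* (con 0ℤ :* D) :+ (con 0ℤ :+ (s :* (con -1ℤ :* D) :+ con 0ℤ))
                                   := s :* (con -1ℤ :* D)) refl
∑-allowed false = solve 2 (λ s D → s :* (con 0ℤ :* D) :+ (s :* (con 1ℤ :* D) :+ (s :* (con -1ℤ :* D) :+ con 0ℤ))
                                   := s :* (con 0ℤ :* D)) refl

module _ {n} (F : Fin (suc n) → Fin (suc n) → Bool) (j : Fin (suc n)) where

  cofactorTerm : Vec Entry (suc n) → Vec (Vec Entry (suc n)) n → ℤ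
  cofactorTerm r rs =
    if admissible F (r ∷ rs) then cofactorSign j * (toℤ (lookup r j) * detᴱ (minor j rs)) else 0ℤ

  private
    Rows = allVecs entries n
    Mats = allVecs Rows n
    S    = admissibleDetSum (minorPattern F j)

    contribution : Entry → ℤ
    contribution x =
      ∑ Rows (λ r → ∑ Rows (λ cs → ∑ Mats (λ N → cofactorTerm (insertAt r j x) (insertColumn j cs N))))

    cofactorTerm-insert : ∀ x r cs N → cofactorTerm (insertAt r j x) (insertColumn j cs N) ≡
      (if admissible F (insertAt r j x ∷ insertColumn j cs N) then cofactorSign j * (toℤ x * detᴱ N) else 0ℤ)
    cofactorTerm-insert x r cs N =
      cong (λ t → if admissible F (insertAt r j x ∷ insertColumn j cs N) then t else 0ℤ)
           (cong (cofactorSign j *_) (cong₂ _*_ (cong toℤ (insertAt-lookup r j x))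
                                                (cong detᴱ (minor-insertColumn j cs N))))

    contribution-nonzero : ∀ x → weight x ≡ 1 →
      contribution x ≡ (if allowed (F zero j) x then cofactorSign j * (toℤ x * S) else 0ℤ)
    contribution-nonzero x wx≡1 = begin
      contribution x
        ≡⟨ ∑-cong Rows (λ r → ∑-cong Rows (λ cs → ∑-cong Mats (λ N → trans (cofactorTerm-insert x r cs N)
             (cong (λ b → if b then v N else 0ℤ) (admissible-insert F j x r cs N wx≡1))))) ⟩
      ∑ Rows (λ r → ∑ Rows (λ cs → ∑ Mats (λ N →
        if allZero r ∧ (allZero cs ∧ rest r cs N) then v N else 0ℤ)))
        ≡⟨ ∑-allVecs-allZero² Mats rest v ⟩
      ∑ Mats (λ N → if rest 0s 0s N then v N else 0ℤ)
        ≡⟨ ∑-cong Mats (λ N → trans (cong (λ b → if b then v N else 0ℤ) (admissible-zeros F j x N))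
                                    (if-∧ (allowed (F zero j) x))) ⟩
      ∑ Mats (λ N → if allowed (F zero j) x then (if admissible F' N then v N else 0ℤ) else 0ℤ)
        ≡⟨ ∑-if Mats (allowed (F zero j) x) _ ⟩
      (if allowed (F zero j) x then ∑ Mats (λ N → if admissible F' N then v N else 0ℤ) else 0ℤ)
        ≡⟨ cong (λ t → if allowed (F zero j) x then t else 0ℤ)
                (∑-if-* Mats (admissible F') (cofactorSign j) (toℤ x) detᴱ) ⟩
      (if allowed (F zero j) x then cofactorSign j * (toℤ x * S) else 0ℤ) ∎
      where
      F' = minorPattern F j
      0s = replicate n zer
      v : Vec (Vec Entry n) n → ℤ
      v N = cofactorSign j * (toℤ x * detᴱ N)
      rest : Vec Entry n → Vec Entry n → Vec (Vec Entry n) n → Bool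
      rest r cs N = (oneNonzeroPerRow (insertColumn j cs N) ∧ oneNonzeroPerRow (transpose (r ∷ N)))
                    ∧ avoids F (insertAt r j x ∷ insertColumn j cs N)

    contribution-zer : contribution zer ≡ 0ℤ
    contribution-zer = ∑-zero Rows (λ r → ∑-zero Rows (λ cs → ∑-zero Mats (λ N →
      trans (cofactorTerm-insert zer r cs N)
            (trans (cong (λ t → if admissible F (insertAt r j zer ∷ insertColumn j cs N) then t else 0ℤ)
                         (*-zeroʳ (cofactorSign j)))
                   (if-eta _)))))

    contribution-allowed : ∀ x →
      contribution x ≡ (if allowed (F zero j) x then cofactorSign j * (toℤ x * S) else 0ℤ)
    contribution-allowed zer = trans contribution-zer (sym (*-zeroʳ (cofactorSign j)))
    contribution-allowed pos = contribution-nonzero pos refl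
    contribution-allowed neg = contribution-nonzero neg refl

  ∑-cofactorTerm : ∑ (allVecs entries (suc n)) (λ r → ∑ (allVecs (allVecs entries (suc n)) n) (cofactorTerm r))
                   ≡ cofactorSign j * (negIf (F zero j) * admissibleDetSum (minorPattern F j))
  ∑-cofactorTerm = begin
    ∑ (allVecs entries (suc n)) (λ r → ∑ Rows' (cofactorTerm r))
      ≡⟨ ∑-allVecs-insertAt entries n j _ ⟩
    ∑ entries (λ x → ∑ Rows (λ r → ∑ Rows' (cofactorTerm (insertAt r j x))))
      ≡⟨ ∑-cong entries (λ x → ∑-cong Rows (λ r →
           ∑-allVecs-insertColumn entries n n j (cofactorTerm (insertAt r j x)))) ⟩
    ∑ entries contribution
      ≡⟨ ∑-cong entries contribution-allowed ⟩
    ∑ entries (λ x → if allowed (F zero j) x then cofactorSign j * (toℤ x * S) else 0ℤ)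
      ≡⟨ ∑-allowed (F zero j) (cofactorSign j) S ⟩
    cofactorSign j * (negIf (F zero j) * S) ∎
    where Rows' = allVecs (allVecs entries (suc n)) n

admissibleDetSum≡det-negIndicator : ∀ n (F : Fin n → Fin n → Bool) →
  admissibleDetSum F ≡ det (negIndicator F)
admissibleDetSum≡det-negIndicator zero    F = refl
admissibleDetSum≡det-negIndicator (suc n) F = begin
  admissibleDetSum F
    ≡⟨ ∑-allVecs-∷ R n _ ⟩
  ∑ R (λ r → ∑ (allVecs R n) (λ rs → if admissible F (r ∷ rs) then detᴱ (r ∷ rs) else 0ℤ))
    ≡⟨ ∑-cong R (λ r → ∑-cong (allVecs R n) (λ rs →
         trans (cong (λ t → if admissible F (r ∷ rs) then t else 0ℤ) (detᴱ-laplace r rs))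
               (sym (∑-if Js (admissible F (r ∷ rs)) _)))) ⟩
  ∑ R (λ r → ∑ (allVecs R n) (λ rs → sumFin (λ j → cofactorTerm F j r rs)))
    ≡⟨ trans (∑-cong R (λ r → ∑-comm (allVecs R n) Js _)) (∑-comm R Js _) ⟩
  sumFin (λ j → ∑ R (λ r → ∑ (allVecs R n) (cofactorTerm F j r)))
    ≡⟨ ∑-cong Js (λ j → trans (∑-cofactorTerm F j)
         (cong (λ t → cofactorSign j * (negIf (F zero j) * t))
               (admissibleDetSum≡det-negIndicator n (minorPattern F j)))) ⟩
  sumFin (λ j → cofactorSign j * (negIf (F zero j) * det (negIndicator (minorPattern F j))))
    ≡⟨ sym (det-negIndicator-laplace F) ⟩
  det (negIndicator F) ∎
  where
  R  = allVecs entries (suc n)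
  Js = toList (allFin (suc n))

-- Counting c-derangements

avoidsRow-diagonal : ∀ (r : Vec Entry n) c →
  avoidsRow (diagonal c) r ≡ not (lookup (Vec.map toℤ r) c == 1ℤ)
avoidsRow-diagonal (x ∷ r) zero    = trans (cong (allowed true x ∧_) (avoidsRow-never r))
                                           (trans (∧-identityʳ _) (notOne x))
  where
  notOne : ∀ x → allowed true x ≡ not (toℤ x == 1ℤ)
  notOne zer = refl
  notOne pos = refl
  notOne neg = refl
avoidsRow-diagonal (x ∷ r) (suc c) =
  trans (cong (_∧ avoidsRow (diagonal (suc c) ∘ suc) r) (allowed-false x)) (avoidsRow-diagonal r c)

avoids-diagonal : ∀ (M : Vec (Vec Entry n) k) (g : Fin k → Fin n) →
  allᵇ (λ i → not (lookup (lookup (toℤᴹ M) i) (g i) == 1ℤ)) (allFin k) ≡ avoids (diagonal ∘ g) M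
avoids-diagonal []      g = refl
avoids-diagonal (r ∷ M) g = cong₂ _∧_ (sym (avoidsRow-diagonal r (g zero)))
  (trans (allᵇ-tabulate (λ i → not (lookup (lookup (toℤᴹ (r ∷ M)) i) (g i) == 1ℤ)) suc)
         (avoids-diagonal M (g ∘ suc)))

allᵇ-entryOK : ∀ (M : Vec (Vec Entry n) k) → allᵇ (allᵇ entryOK) (toℤᴹ M) ≡ true
allᵇ-entryOK []      = refl
allᵇ-entryOK (r ∷ M) = cong₂ _∧_ (row r) (allᵇ-entryOK M)
  where
  row : ∀ {n} (r : Vec Entry n) → allᵇ entryOK (Vec.map toℤ r) ≡ true
  row []        = refl
  row (zer ∷ r) = row r
  row (pos ∷ r) = row r
  row (neg ∷ r) = row r

nonzeros-toℤ : ∀ (r : Vec Entry n) → nonzeros (Vec.map toℤ r) ≡ nonzeroCount r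
nonzeros-toℤ []        = refl
nonzeros-toℤ (zer ∷ r) = nonzeros-toℤ r
nonzeros-toℤ (pos ∷ r) = cong suc (nonzeros-toℤ r)
nonzeros-toℤ (neg ∷ r) = cong suc (nonzeros-toℤ r)

oneNonzeroPerRow-toℤᴹ : ∀ (M : Vec (Vec Entry n) k) →
  allᵇ (λ r → isOne (nonzeros r)) (toℤᴹ M) ≡ oneNonzeroPerRow M
oneNonzeroPerRow-toℤᴹ []      = refl
oneNonzeroPerRow-toℤᴹ (r ∷ M) = cong₂ _∧_ (cong isOne (nonzeros-toℤ r)) (oneNonzeroPerRow-toℤᴹ M)

isCDerangement-toℤᴹ : ∀ (M : Vec (Vec Entry n) n) → isCDerangement (toℤᴹ M) ≡ admissible diagonal M
isCDerangement-toℤᴹ M = cong₂ _∧_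
  (cong₂ _∧_ (allᵇ-entryOK M) (cong₂ _∧_ (oneNonzeroPerRow-toℤᴹ M)
    (trans (cong (allᵇ _) (transpose-map toℤ M)) (oneNonzeroPerRow-toℤᴹ (transpose M)))))
  (avoids-diagonal M id)

∑-candidateMatrices : ∀ n (h : Matrix n → ℤ) →
  ∑ (candidateMatrices n) h ≡ ∑ (allVecs (allVecs entries n) n) (h ∘ toℤᴹ)
-- The candidate entries 0, 1, -1 are listed in the order of entries, hence refl.
∑-candidateMatrices n = ∑-allVecs-map (Vec.map toℤ) _ (allVecs entries n)
  (∑-allVecs-map toℤ (0ℤ ∷ 1ℤ ∷ -1ℤ ∷ []) entries (λ _ → refl) n) n

signedIndicator : ∀ c d → (c ≡ true → Trivalent d) →
  (if c ∧ (d == 1ℤ) then 1ℤ else 0ℤ) - (if c ∧ (d == -1ℤ) then 1ℤ else 0ℤ) ≡ (if c then d else 0ℤ)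
signedIndicator false d _ = refl
signedIndicator true  d t with t refl
... | zer , refl = refl
... | pos , refl = refl
... | neg , refl = refl

signedIndicator-cDerangement : ∀ (M : Vec (Vec Entry n) n) →
  (if isCDerangement (toℤᴹ M) ∧ (det (toℤᴹ M) == 1ℤ) then 1ℤ else 0ℤ)
    - (if isCDerangement (toℤᴹ M) ∧ (det (toℤᴹ M) == -1ℤ) then 1ℤ else 0ℤ)
  ≡ (if admissible diagonal M then detᴱ M else 0ℤ)
signedIndicator-cDerangement M rewrite isCDerangement-toℤᴹ M =
  signedIndicator (admissible diagonal M) (detᴱ M) (λ adm →
    trivalent-detᴱ M (oneNonzeroPerRow⇒≤1 M (∧-conicalˡ _ _ (∧-conicalˡ _ _ adm))))

theorem4p3 : (n : ℕ) → n ≥ 1 →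
    (+ directCDerangements n) - (+ indirectCDerangements n) ≡ negOnePow n
theorem4p3 n _ = begin
  (+ directCDerangements n) - (+ indirectCDerangements n)
    ≡⟨ cong₂ _-_ (length-filterᵇ (counts 1ℤ) (candidateMatrices n))
                 (length-filterᵇ (counts -1ℤ) (candidateMatrices n)) ⟩
  ∑ (candidateMatrices n) (indicator 1ℤ) - ∑ (candidateMatrices n) (indicator -1ℤ)
    ≡⟨ ∑-distrib-minus (candidateMatrices n) (indicator 1ℤ) (indicator -1ℤ) ⟩
  ∑ (candidateMatrices n) (λ M → indicator 1ℤ M - indicator -1ℤ M)
    ≡⟨ ∑-candidateMatrices n _ ⟩
  ∑ (allVecs (allVecs entries n) n) (λ M → indicator 1ℤ (toℤᴹ M) - indicator -1ℤ (toℤᴹ M))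
    ≡⟨ ∑-cong (allVecs (allVecs entries n) n) signedIndicator-cDerangement ⟩
  admissibleDetSum (diagonal {n})
    ≡⟨ admissibleDetSum≡det-negIndicator n diagonal ⟩
  det (negIndicator (diagonal {n}))
    ≡⟨ det-negIdentity n ⟩
  negOnePow n ∎
  where
  counts : ℤ → Matrix n → Bool
  counts d M = isCDerangement M ∧ (det M == d)
  indicator : ℤ → Matrix n → ℤ
  indicator d M = if counts d M then 1ℤ else 0ℤ
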